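{- Let $E$ be a finite set and consider a problem $\Pi$ whose feasible sets are described as follows: there is a finite family $S$ of linear "structural" constraints $\sum_{e\in E} a_{e,i}x_e\ge b_i$ ($i\in S$) and a finite index set $K$ of "additional" constraints $f^j(x)\ge 0$ ($j\in K$), where each $f^j$ is an arbitrary function on $\{0,1\}^E$. Let $\mathcal{F}$ be the family of sets $F\subseteq E$ whose incidence vector satisfies all structural and all additional constraints, and for $j\in K$ let $\mathcal{F}_j$ be the family of sets $F\subseteq E$ whose incidence vector satisfies all structural constraints and the additional constraint $f^j\ge 0$. Assume $\Pi$ is union-free. Let $x\in\{0,1\}^E$ and real numbers $y^j_F\ge 0$ ($j\in K$, $F\in\mathcal{F}_j$) satisfy (i) $\sum_{e\in E}a_{e,i}x_e\ge b_i$ for all $i\in S$; (ii) $\sum_{F\in\mathcal{F}_j}y^j_F=1$ for all $j\in K$; (iii) $x_e-\sum_{F\in\mathcal{F}_j:\,e\in F}y^j_F=0$ for all $j\in K$, $e\in E$. Then every $y^j_F$ is integer (i.e. $y^j_F\in\{0,1\}$).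
   Context: The problem $\Pi$ is said to be union-free if and only if for each pair of constraints $j_1,j_2\in K$ there do not exist $F_{j_1}\in\mathcal{F}_{j_1}$ and $F_{j_2}\in\mathcal{F}_{j_2}$ with $F_{j_1}\neq F_{j_2}$ and $F_{j_1}\cup F_{j_2}\in\mathcal{F}$. The variables $y^j_F$ are indexed by distinct sets $F\in\mathcal{F}_j$.
   Formalization: The coefficients $a_{e,i}$, the right-hand sides $b_i$ and the values of each $f^j$ are rational, and the weights $y^j_F$ are rational rather than real numbers. -}

module Defs where

open import Data.Nat using (ℕ; zero; suc)
open import Data.Bool using (Bool; true; false; if_then_else_)
open import Data.Fin using (Fin)
open import Data.Fin.Subset using (Subset; _∈_; _∪_)
open import Data.Fin.Subset.Properties using (_∈?_)
open import Data.Fin.Properties using (all?)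
open import Data.List using (List; []; _∷_; map; foldr; _++_; allFin)
open import Data.Vec using (lookup; _∷_; [])
open import Data.Rational using (ℚ; 0ℚ; 1ℚ; _+_; _*_; _≤_)
open import Data.Rational.Properties using (_≤?_)
open import Data.Product using (_×_)
open import Relation.Nullary using (Dec; ¬_; _×-dec_)
open import Relation.Nullary.Decidable using (⌊_⌋)
open import Relation.Binary.PropositionalEquality using (_≢_)

-- Ground set E = Fin n; subsets / 0-1 vectors on E are `Subset n`.
-- Real data are represented by rationals.

χ : Bool → ℚ
χ true  = 1ℚ
χ false = 0ℚ

Σℚ : {A : Set} → List A → (A → ℚ) → ℚ
Σℚ xs g = foldr (λ a acc → g a + acc) 0ℚ xs

allSubsets : (n : ℕ) → List (Subset n)
allSubsets zero    = [] ∷ []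
allSubsets (suc n) = map (true ∷_) (allSubsets n) ++ map (false ∷_) (allSubsets n)

linVal : {n : ℕ} → (Fin n → ℚ) → Subset n → ℚ
linVal {n} a x = Σℚ (allFin n) (λ e → a e * χ (lookup x e))

-- A problem Π on E = Fin n with structural constraints indexed by S = Fin s
-- (coefficients a i e, right-hand sides b i) and additional constraints
-- indexed by K = Fin k (functions f j on {0,1}^E).
record Problem (n s k : ℕ) : Set where
  field
    a : Fin s → Fin n → ℚ
    b : Fin s → ℚ
    f : Fin k → Subset n → ℚ

module _ {n s k : ℕ} (Π : Problem n s k) where
  open Problem Π

  Structural : Subset n → Set
  Structural x = ∀ i → b i ≤ linVal (a i) x

  In𝓕 : Subset n → Set
  In𝓕 F = Structural F × (∀ j → 0ℚ ≤ f j F)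

  In𝓕ⱼ : Fin k → Subset n → Set
  In𝓕ⱼ j F = Structural F × (0ℚ ≤ f j F)

  In𝓕ⱼ? : ∀ j F → Dec (In𝓕ⱼ j F)
  In𝓕ⱼ? j F = all? (λ i → b i ≤? linVal (a i) F) ×-dec (0ℚ ≤? f j F)

  UnionFree : Set
  UnionFree = ∀ j₁ j₂ F₁ F₂ → In𝓕ⱼ j₁ F₁ → In𝓕ⱼ j₂ F₂ → F₁ ≢ F₂ → ¬ In𝓕 (F₁ ∪ F₂)

  Σ𝓕ⱼ : Fin k → (Subset n → ℚ) → ℚ
  Σ𝓕ⱼ j g = Σℚ (allSubsets n) (λ F → if ⌊ In𝓕ⱼ? j F ⌋ then g F else 0ℚ)

  Σ𝓕ⱼ∋ : Fin k → Fin n → (Subset n → ℚ) → ℚ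
  Σ𝓕ⱼ∋ j e g = Σ𝓕ⱼ j (λ F → if ⌊ e ∈? F ⌋ then g F else 0ℚ)

{-# OPTIONS --safe #-}
-- Fix j and let w(F) be y^j_F on 𝓕_j and 0 elsewhere: a probability
-- distribution on subsets of E whose marginals P(e ∈ F) are the 0/1 values
-- x_e. If F ≠ x, pick e with F_e ≠ x_e. When e ∈ F, e ∉ x, the weight w(F)
-- is bounded by P(e ∈ F) = 0; when e ∉ F, e ∈ x, it is bounded by
-- P(e ∉ F) = 1 - 1 = 0. So w is the point mass at x, and every y^j_F is
-- 0 or 1.
module Submission where

open import Defs
open import Data.Nat using (ℕ; suc)
open import Data.Bool using (Bool; true; false; not; if_then_else_)
import Data.Bool as Bool
open import Data.Fin using (Fin)
open import Data.Fin.Properties using (¬∀⟶∃¬)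
open import Data.Fin.Subset using (Subset; _∈_; _∉_)
open import Data.Fin.Subset.Properties using (_∈?_)
open import Data.List using (List; []; _∷_; map; _++_)
open import Data.List.Membership.Propositional using () renaming (_∈_ to _∈ₗ_)
open import Data.List.Membership.Propositional.Properties using (∈-map⁺; ∈-++⁺ˡ; ∈-++⁺ʳ)
open import Data.List.Relation.Unary.Any using (here; there)
open import Data.Vec using (lookup; _∷_; [])
open import Data.Vec.Properties using (lookup⇒[]=; []=⇒lookup; tabulate∘lookup; tabulate-cong; ∷-injectiveʳ; ≡-dec)
open import Data.Rational using (ℚ; 0ℚ; 1ℚ; _≤_; _-_; _+_)
open import Data.Rational.Properties
  using (≤-refl; ≤-antisym; +-mono-≤; +-monoˡ-≤; +-monoʳ-≤; +-identityˡ; +-identityʳ; +-assoc;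
         +-0-group; +-0-commutativeMonoid; module ≤-Reasoning)
open import Algebra.Bundles using (CommutativeMonoid)
open import Algebra.Properties.Group +-0-group using (identityʳ-unique; x∙y⁻¹≈ε⇒x≈y)
open import Algebra.Properties.CommutativeSemigroup
  (CommutativeMonoid.commutativeSemigroup +-0-commutativeMonoid) using (interchange)
open import Data.Sum using (_⊎_; inj₁; inj₂)
open import Data.Product using (∃; _,_)
open import Function using (_∘_; case_of_)
open import Data.Empty using (⊥-elim)
open import Relation.Nullary using (Dec; ¬_; yes; no)
open import Relation.Nullary.Decidable using (⌊_⌋; isYes≗does; dec-true; dec-false)
open import Relation.Binary.PropositionalEquality
  using (_≡_; _≢_; _≗_; refl; sym; trans; cong; cong₂; subst; module ≡-Reasoning)

module _ {A : Set} where

  ⌊⌋-true : (A? : Dec A) → A → ⌊ A? ⌋ ≡ true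
  ⌊⌋-true A? a = trans (isYes≗does A?) (dec-true A? a)

  ⌊⌋-false : (A? : Dec A) → ¬ A → ⌊ A? ⌋ ≡ false
  ⌊⌋-false A? ¬a = trans (isYes≗does A?) (dec-false A? ¬a)

  Σℚ-cong : (l : List A) {g h : A → ℚ} → g ≗ h → Σℚ l g ≡ Σℚ l h
  Σℚ-cong []      g≗h = refl
  Σℚ-cong (a ∷ l) g≗h = cong₂ _+_ (g≗h a) (Σℚ-cong l g≗h)

  Σℚ-zero : (l : List A) {g : A → ℚ} → (∀ a → g a ≡ 0ℚ) → Σℚ l g ≡ 0ℚ
  Σℚ-zero []      g≡0 = refl
  Σℚ-zero (a ∷ l) g≡0 = cong₂ _+_ (g≡0 a) (Σℚ-zero l g≡0)

  Σℚ-+ : (l : List A) (g h : A → ℚ) → Σℚ l (λ a → g a + h a) ≡ Σℚ l g + Σℚ l h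
  Σℚ-+ []      g h = refl
  Σℚ-+ (a ∷ l) g h = begin
    (g a + h a) + Σℚ l (λ b → g b + h b) ≡⟨ cong ((g a + h a) +_) (Σℚ-+ l g h) ⟩
    (g a + h a) + (Σℚ l g + Σℚ l h)     ≡⟨ interchange (g a) (h a) (Σℚ l g) (Σℚ l h) ⟩
    (g a + Σℚ l g) + (h a + Σℚ l h)     ∎
    where open ≡-Reasoning

  Σℚ-++ : (l₁ l₂ : List A) (g : A → ℚ) → Σℚ (l₁ ++ l₂) g ≡ Σℚ l₁ g + Σℚ l₂ g
  Σℚ-++ []       l₂ g = sym (+-identityˡ _)
  Σℚ-++ (a ∷ l₁) l₂ g = trans (cong (g a +_) (Σℚ-++ l₁ l₂ g)) (sym (+-assoc (g a) _ _))

  Σℚ-map : {B : Set} (f : B → A) (l : List B) (g : A → ℚ) → Σℚ (map f l) g ≡ Σℚ l (g ∘ f)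
  Σℚ-map f []      g = refl
  Σℚ-map f (b ∷ l) g = cong (g (f b) +_) (Σℚ-map f l g)

  module _ {g : A → ℚ} (g≥0 : ∀ a → 0ℚ ≤ g a) where
    open ≤-Reasoning

    Σℚ-nonneg : (l : List A) → 0ℚ ≤ Σℚ l g
    Σℚ-nonneg []      = ≤-refl
    Σℚ-nonneg (a ∷ l) = +-mono-≤ (g≥0 a) (Σℚ-nonneg l)

    ∈⇒≤Σℚ : {a : A} {l : List A} → a ∈ₗ l → g a ≤ Σℚ l g
    ∈⇒≤Σℚ {l = a ∷ l} (here refl) = begin
      g a           ≡⟨ sym (+-identityʳ (g a)) ⟩
      g a + 0ℚ      ≤⟨ +-monoʳ-≤ (g a) (Σℚ-nonneg l) ⟩
      g a + Σℚ l g  ∎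
    ∈⇒≤Σℚ {l = b ∷ l} (there a∈l) = begin
      g _           ≤⟨ ∈⇒≤Σℚ a∈l ⟩
      Σℚ l g        ≡⟨ sym (+-identityˡ (Σℚ l g)) ⟩
      0ℚ + Σℚ l g   ≤⟨ +-monoˡ-≤ (Σℚ l g) (g≥0 b) ⟩
      g b + Σℚ l g  ∎

  ∈⇒≤Σℚ-if : (p : A → Bool) {g : A → ℚ} → (∀ a → 0ℚ ≤ g a) → {a : A} {l : List A} →
    p a ≡ true → a ∈ₗ l → g a ≤ Σℚ l (λ b → if p b then g b else 0ℚ)
  ∈⇒≤Σℚ-if p {g} g≥0 {a} pa a∈l =
    subst (_≤ _) (cong (λ c → if c then g a else 0ℚ) pa) (∈⇒≤Σℚ if≥0 a∈l)
    where
    if≥0 : ∀ b → 0ℚ ≤ (if p b then g b else 0ℚ)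
    if≥0 b with p b
    ... | true  = g≥0 b
    ... | false = ≤-refl

∈-allSubsets : ∀ {n} (F : Subset n) → F ∈ₗ allSubsets n
∈-allSubsets []            = here refl
∈-allSubsets {suc n} (true  ∷ F) = ∈-++⁺ˡ (∈-map⁺ (true ∷_) (∈-allSubsets F))
∈-allSubsets {suc n} (false ∷ F) =
  ∈-++⁺ʳ (map (true ∷_) (allSubsets n)) (∈-map⁺ (false ∷_) (∈-allSubsets F))

Σℚ-allSubsets-suc : ∀ {n} (g : Subset (suc n) → ℚ) →
  Σℚ (allSubsets (suc n)) g ≡ Σℚ (allSubsets n) (g ∘ (true ∷_)) + Σℚ (allSubsets n) (g ∘ (false ∷_))
Σℚ-allSubsets-suc {n} g = trans
  (Σℚ-++ (map (true ∷_) (allSubsets n)) (map (false ∷_) (allSubsets n)) g)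
  (cong₂ _+_ (Σℚ-map (true ∷_) (allSubsets n) g) (Σℚ-map (false ∷_) (allSubsets n) g))

Σℚ-allSubsets-point : ∀ {n} (g : Subset n → ℚ) (F : Subset n) →
  (∀ G → G ≢ F → g G ≡ 0ℚ) → Σℚ (allSubsets n) g ≡ g F
Σℚ-allSubsets-point g [] _ = +-identityʳ (g [])
Σℚ-allSubsets-point {suc n} g (true ∷ F) g≡0 = begin
  Σℚ (allSubsets (suc n)) g
    ≡⟨ Σℚ-allSubsets-suc g ⟩
  Σℚ (allSubsets n) (g ∘ (true ∷_)) + Σℚ (allSubsets n) (g ∘ (false ∷_))
    ≡⟨ cong₂ _+_ (Σℚ-allSubsets-point (g ∘ (true ∷_)) F (λ G G≢F → g≡0 _ (G≢F ∘ ∷-injectiveʳ)))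
                 (Σℚ-zero (allSubsets n) (λ G → g≡0 _ λ ())) ⟩
  g (true ∷ F) + 0ℚ
    ≡⟨ +-identityʳ _ ⟩
  g (true ∷ F) ∎
  where open ≡-Reasoning
Σℚ-allSubsets-point {suc n} g (false ∷ F) g≡0 = begin
  Σℚ (allSubsets (suc n)) g
    ≡⟨ Σℚ-allSubsets-suc g ⟩
  Σℚ (allSubsets n) (g ∘ (true ∷_)) + Σℚ (allSubsets n) (g ∘ (false ∷_))
    ≡⟨ cong₂ _+_ (Σℚ-zero (allSubsets n) (λ G → g≡0 _ λ ()))
                 (Σℚ-allSubsets-point (g ∘ (false ∷_)) F (λ G G≢F → g≡0 _ (G≢F ∘ ∷-injectiveʳ))) ⟩
  0ℚ + g (false ∷ F)
    ≡⟨ +-identityˡ _ ⟩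
  g (false ∷ F) ∎
  where open ≡-Reasoning

≢⇒∃-lookup-≢ : ∀ {n} {F G : Subset n} → F ≢ G → ∃ λ e → lookup F e ≢ lookup G e
≢⇒∃-lookup-≢ {n} {F} {G} F≢G = ¬∀⟶∃¬ n _ (λ e → lookup F e Bool.≟ lookup G e) λ F≗G →
  F≢G (trans (sym (tabulate∘lookup F)) (trans (tabulate-cong F≗G) (tabulate∘lookup G)))

module PointMass {n : ℕ} (w : Subset n → ℚ) (w≥0 : ∀ F → 0ℚ ≤ w F) where

  w∋ w∌ : Fin n → Subset n → ℚ
  w∋ e F = if ⌊ e ∈? F ⌋ then w F else 0ℚ
  w∌ e F = if not ⌊ e ∈? F ⌋ then w F else 0ℚ

  marginal comarginal : Fin n → ℚ
  marginal   e = Σℚ (allSubsets n) (w∋ e)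
  comarginal e = Σℚ (allSubsets n) (w∌ e)

  Σw≡marginal+comarginal : ∀ e → Σℚ (allSubsets n) w ≡ marginal e + comarginal e
  Σw≡marginal+comarginal e = trans (Σℚ-cong (allSubsets n) split) (Σℚ-+ (allSubsets n) (w∋ e) (w∌ e))
    where
    split : ∀ F → w F ≡ w∋ e F + w∌ e F
    split F with ⌊ e ∈? F ⌋
    ... | true  = sym (+-identityʳ (w F))
    ... | false = sym (+-identityˡ (w F))

  w≤marginal : ∀ {e F} → e ∈ F → w F ≤ marginal e
  w≤marginal {e} {F} e∈F = ∈⇒≤Σℚ-if (λ G → ⌊ e ∈? G ⌋) w≥0 (⌊⌋-true (e ∈? F) e∈F) (∈-allSubsets F)

  w≤comarginal : ∀ {e F} → e ∉ F → w F ≤ comarginal e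
  w≤comarginal {e} {F} e∉F =
    ∈⇒≤Σℚ-if (λ G → not ⌊ e ∈? G ⌋) w≥0 (cong not (⌊⌋-false (e ∈? F) e∉F)) (∈-allSubsets F)

  module _ (x : Subset n) (Σw≡1 : Σℚ (allSubsets n) w ≡ 1ℚ)
           (marginal≡x : ∀ e → marginal e ≡ χ (lookup x e)) where

    w≡0-if-lookup-≢ : ∀ {F} e → lookup F e ≢ lookup x e → w F ≡ 0ℚ
    w≡0-if-lookup-≢ {F} e Fₑ≢xₑ with lookup F e in Fₑ | lookup x e in xₑ
    ... | true  | true  = ⊥-elim (Fₑ≢xₑ refl)
    ... | false | false = ⊥-elim (Fₑ≢xₑ refl)
    ... | true  | false = ≤-antisym w≤0 (w≥0 F)
      where
      w≤0 : w F ≤ 0ℚ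
      w≤0 = subst (w F ≤_) (trans (marginal≡x e) (cong χ xₑ)) (w≤marginal (lookup⇒[]= e F Fₑ))
    ... | false | true  = ≤-antisym w≤0 (w≥0 F)
      where
      1+comarginal≡1 : 1ℚ + comarginal e ≡ 1ℚ
      1+comarginal≡1 = begin
        1ℚ + comarginal e                 ≡⟨ cong (λ m → m + comarginal e) (trans (marginal≡x e) (cong χ xₑ)) ⟨
        marginal e + comarginal e         ≡⟨ Σw≡marginal+comarginal e ⟨
        Σℚ (allSubsets n) w               ≡⟨ Σw≡1 ⟩
        1ℚ                                ∎
        where open ≡-Reasoning
      w≤0 : w F ≤ 0ℚ
      w≤0 = subst (w F ≤_) (identityʳ-unique 1ℚ (comarginal e) 1+comarginal≡1)
              (w≤comarginal (λ e∈F → case trans (sym ([]=⇒lookup e∈F)) Fₑ of λ ()))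

    w≡0-off-x : ∀ {F} → F ≢ x → w F ≡ 0ℚ
    w≡0-off-x F≢x = let e , Fₑ≢xₑ = ≢⇒∃-lookup-≢ F≢x in w≡0-if-lookup-≢ e Fₑ≢xₑ

    w≡1-at-x : w x ≡ 1ℚ
    w≡1-at-x = trans (sym (Σℚ-allSubsets-point w x (λ G → w≡0-off-x))) Σw≡1

    w≡0⊎w≡1 : ∀ F → w F ≡ 0ℚ ⊎ w F ≡ 1ℚ
    w≡0⊎w≡1 F with ≡-dec Bool._≟_ F x
    ... | yes refl = inj₂ w≡1-at-x
    ... | no  F≢x  = inj₁ (w≡0-off-x F≢x)

proposition7 : {n s k : ℕ} (Π : Problem n s k) → UnionFree Π →
    (x : Subset n) (y : Fin k → Subset n → ℚ) →
    (∀ j F → In𝓕ⱼ Π j F → 0ℚ ≤ y j F) →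
    Structural Π x →
    (∀ j → Σ𝓕ⱼ Π j (y j) ≡ 1ℚ) →
    (∀ j e → χ (lookup x e) - Σ𝓕ⱼ∋ Π j e (y j) ≡ 0ℚ) →
    ∀ j F → In𝓕ⱼ Π j F → (y j F ≡ 0ℚ ⊎ y j F ≡ 1ℚ)
proposition7 Π _ x y y≥0 _ Σy≡1 x-Σy≡0 j F F∈𝓕ⱼ =
  subst (λ v → v ≡ 0ℚ ⊎ v ≡ 1ℚ) (w≡y F∈𝓕ⱼ) (w≡0⊎w≡1 x (Σy≡1 j) marginal≡x F)
  where
  w : Subset _ → ℚ
  w G = if ⌊ In𝓕ⱼ? Π j G ⌋ then y j G else 0ℚ

  w≡y : ∀ {G} → In𝓕ⱼ Π j G → w G ≡ y j G
  w≡y {G} G∈𝓕ⱼ = cong (λ c → if c then y j G else 0ℚ) (⌊⌋-true (In𝓕ⱼ? Π j G) G∈𝓕ⱼ)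

  w≥0 : ∀ G → 0ℚ ≤ w G
  w≥0 G with In𝓕ⱼ? Π j G
  ... | yes G∈𝓕ⱼ = y≥0 j G G∈𝓕ⱼ
  ... | no  _    = ≤-refl

  open PointMass w w≥0

  marginal≡x : ∀ e → marginal e ≡ χ (lookup x e)
  marginal≡x e = sym (trans (x∙y⁻¹≈ε⇒x≈y _ _ (x-Σy≡0 j e)) (Σℚ-cong (allSubsets _) swap-if))
    where
    swap-if : ∀ G → (if ⌊ In𝓕ⱼ? Π j G ⌋ then (if ⌊ e ∈? G ⌋ then y j G else 0ℚ) else 0ℚ)
                  ≡ (if ⌊ e ∈? G ⌋ then w G else 0ℚ)
    swap-if G with ⌊ In𝓕ⱼ? Π j G ⌋ | ⌊ e ∈? G ⌋
    ... | true  | _     = refl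
    ... | false | true  = refl
    ... | false | false = refl
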